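{- Let $C$ be a $[g_q(k,d),k,d]_q$ Griesmer code, let $a\in C$ with $\mathrm{wt}(a)=d$, let $P_a:C\to\mathrm{Res}(C,a)$ be the puncturing map, and let $c'$ be a nonzero codeword of minimum weight in $\mathrm{Res}(C,a)$. (1) If $q\mid d$, then every preimage of $c'$ under $P_a$ has weight $d$; i.e., the number of preimages of $c'$ of weight $d$ is $q$. (2) If $q\nmid d$, then there exists a preimage of $c'$ of weight $d$, and the number of such preimages is at least $d+q-\lceil d/q\rceil q$. In particular, $c'$ always has a preimage of weight $d$ in $C$.
   Context: An $[n,k,d]_q$ code is a $k$-dimensional subspace of $\mathbb{F}_q^n$ with minimum nonzero Hamming weight $d$; $g_q(k,d)=\sum_{i=0}^{k-1}\lceil d/q^i\rceil$ and a code of length $g_q(k,d)$ is a Griesmer code. For $a\in\mathbb{F}_q^n$ with support $\mathrm{supp}(a)=\{i:a_i\neq0\}$, $\mathrm{Res}(C,a)$ is the code obtained by deleting the coordinates in $\mathrm{supp}(a)$ from all codewords, and $P_a(c)$ is the word obtained by deleting those coordinates from $c$ (a linear map whose kernel is $\langle a\rangle$). -}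

module Defs where

open import Data.Nat using (ℕ; zero; suc; _^_; _≟_) renaming (_+_ to _+ℕ_; _∸_ to _∸ℕ_)
open import Data.Nat.DivMod using (_/_)
open import Data.Fin using (Fin; zero; suc)
open import Data.List using (List; []; _∷_; length; map; filter; foldr; concatMap; allFin)
open import Data.List.Properties using (≡-dec)
open import Data.List.Membership.Propositional using (_∈_)
open import Data.List.Relation.Unary.Any using (Any)
open import Data.List.Relation.Unary.Unique.Propositional using (Unique)
open import Data.Product using (Σ; ∃; _×_; _,_)
open import Relation.Binary.PropositionalEquality using (_≡_; _≢_)
open import Relation.Binary.Definitions using (DecidableEquality)
open import Relation.Nullary using (¬_)
open import Relation.Nullary.Decidable using (¬?; _×-dec_)
open import Algebra.Structures using (IsCommutativeRing)
open import Algebra.Core using (Op₁; Op₂)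

record FiniteField : Set₁ where
  field
    Carrier           : Set
    _+_ _*_           : Op₂ Carrier
    -_                : Op₁ Carrier
    0# 1#             : Carrier
    isCommutativeRing : IsCommutativeRing _≡_ _+_ _*_ -_ 0# 1#
    0≢1               : 0# ≢ 1#
    inverse           : ∀ x → x ≢ 0# → ∃ λ y → x * y ≡ 1#
    _≟F_              : DecidableEquality Carrier
    elements          : List Carrier
    elements-unique   : Unique elements
    elements-complete : ∀ x → x ∈ elements

  q : ℕ
  q = length elements

-- ceiling division ⌈a/b⌉ (for b ≥ 1; value 0 when b = 0, never used)
ceilDiv : ℕ → ℕ → ℕ
ceilDiv a zero    = 0
ceilDiv a (suc b) = (a +ℕ b) / suc b

griesmer : ℕ → ℕ → ℕ → ℕ
griesmer q zero    d = 0
griesmer q (suc k) d = griesmer q k d +ℕ ceilDiv d (q ^ k)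

module Code (F : FiniteField) where
  open FiniteField F

  Word : ℕ → Set
  Word n = Fin n → Carrier

  listWt : List Carrier → ℕ
  listWt w = length (filter (λ x → ¬? (x ≟F 0#)) w)

  toList : ∀ {n} → Word n → List Carrier
  toList {n} w = map w (allFin n)

  wt : ∀ {n} → Word n → ℕ
  wt w = listWt (toList w)

  NonzeroL : List Carrier → Set
  NonzeroL w = Any (λ x → x ≢ 0#) w

  Nonzero : ∀ {n} → Word n → Set
  Nonzero {n} w = ∃ λ (j : Fin n) → w j ≢ 0#

  -- A linear code is given by a generator matrix G (k rows of length n);
  -- the codewords are the linear combinations  m G  of its rows.
  GenMatrix : ℕ → ℕ → Set
  GenMatrix k n = Fin k → Word n

  encode : ∀ {k n} → GenMatrix k n → (Fin k → Carrier) → Word n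
  encode {k} G m j = foldr (λ i acc → (m i * G i j) + acc) 0# (allFin k)

  InCode : ∀ {k n} → GenMatrix k n → Word n → Set
  InCode {k} {n} G c = ∃ λ (m : Fin k → Carrier) → ∀ j → encode G m j ≡ c j

  LinIndep : ∀ {k n} → GenMatrix k n → Set
  LinIndep {k} {n} G = ∀ (m : Fin k → Carrier) → (∀ j → encode G m j ≡ 0#) → ∀ i → m i ≡ 0#

  IsCode : (n k d : ℕ) → GenMatrix k n → Set
  IsCode n k d G =
      LinIndep G
    × (∀ c → InCode G c → Nonzero c → Data.Nat._≤_ d (wt c))
    × (∃ λ c → InCode G c × Nonzero c × wt c ≡ d)

  puncture : ∀ {n} → Word n → Word n → List Carrier
  puncture {n} a c = map c (filter (λ i → a i ≟F 0#) (allFin n))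

  InRes : ∀ {k n} → GenMatrix k n → Word n → List Carrier → Set
  InRes G a c' = ∃ λ c → InCode G c × puncture a c ≡ c'

  MinWtRes : ∀ {k n} → GenMatrix k n → Word n → List Carrier → Set
  MinWtRes G a c' =
      InRes G a c'
    × NonzeroL c'
    × (∀ c → InCode G c → NonzeroL (puncture a c) → Data.Nat._≤_ (listWt c') (listWt (puncture a c)))

  messages : (k : ℕ) → List (Fin k → Carrier)
  messages zero    = (λ ()) ∷ []
  messages (suc k) = concatMap (λ x → map (λ m → λ { zero → x ; (suc i) → m i }) (messages k)) elements

  -- number of codewords c = mG ∈ C with P_a(c) = c' and wt(c) = w
  -- (m ↦ mG is a bijection F_q^k → C since G has independent rows)
  numPreimagesOfWt : ∀ {k n} → GenMatrix k n → Word n → List Carrier → ℕ → ℕ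
  numPreimagesOfWt {k} G a c' w =
    length (filter (λ m → ≡-dec _≟F_ (puncture a (encode G m)) c' ×-dec (wt (encode G m) ≟ w)) (messages k))

-- The kernel of the puncturing map P_a is ⟨a⟩: subtracting a suitable multiple of a from a codeword
-- that vanishes off supp(a) but is not a multiple of a leaves a nonzero codeword lighter than a.
-- Hence if c' = P_a(c₀), the preimages of c' are the q distinct words c₀ + λa. On supp(a) each
-- coordinate of c + λa vanishes for exactly one λ, so for every codeword c
--   ∑_λ wt(c + λa) = q·wt(P_a c) + (q − 1)·d,
-- and each term is at least d when P_a(c) ≠ 0. This gives wt(P_a c) ≥ ⌈d/q⌉, so Res(C,a) is a code
-- of dimension k − 1, minimum weight wt(c') and length g_q(k,d) − d = g_q(k − 1, ⌈d/q⌉), and the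
-- Griesmer bound for it forces wt(c') ≤ ⌈d/q⌉. The identity for c = c₀ then shows that at least
-- d + q − ⌈d/q⌉q of its q terms equal d, and that all of them do when q ∣ d.
module Submission where

open import Defs
open import Algebra.Bundles using (CommutativeRing)
import Algebra.Properties.CommutativeSemigroup as CommutativeSemigroupProperties
import Algebra.Properties.Group as GroupProperties
import Algebra.Properties.Ring as RingProperties
import Algebra.Properties.Semiring.Sum as SemiringSum
open import Data.Empty using (⊥-elim)
open import Data.Fin using (Fin; zero; suc; punchIn)
open import Data.Fin.Properties using (¬∀⟶∃¬)
open import Data.List using (List; []; _∷_; length; map; filter; concatMap; _++_; foldr; tabulate; allFin)
open import Data.List.Properties using (≡-dec; map-cong; map-cong-local; length-tabulate)
open import Data.List.Membership.Propositional using (_∈_; find)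
open import Data.List.Membership.Propositional.Properties using (∈-filter⁺; ∈-allFin)
open import Data.List.Relation.Unary.All as All using (All; []; _∷_)
open import Data.List.Relation.Unary.All.Properties using (all-filter; ¬Any⇒All¬)
open import Data.List.Relation.Unary.Any as Any using (Any; here; there; any?)
import Data.List.Relation.Unary.Any.Properties as Anyₚ
open import Data.List.Relation.Unary.AllPairs using (_∷_)
open import Data.List.Relation.Unary.Unique.Propositional using (Unique)
open import Data.Nat using (ℕ; zero; suc; _≤_; _<_; _+_; _∸_; _*_; _^_; z≤n; s≤s; NonZero; >-nonZero; _≟_; _≤?_)
open import Data.Nat.Divisibility using (_∣_)
open import Data.Nat.DivMod using (_/_; _%_; m≡m%n+[m/n]*n; m%n<n; m<n*o⇒m/o<n; m/n*n≤m; n/1≡n)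
open import Data.Nat.Properties
open import Data.Nat.Tactic.RingSolver using (solve-∀)
open import Data.Product using (∃; _×_; _,_; proj₁; proj₂)
open import Data.Vec.Functional using (insertAt; removeAt)
open import Data.Vec.Functional.Properties using (insertAt-lookup; insertAt-punchIn)
open import Function using (_∘_; id)
open import Relation.Binary.Definitions using (DecidableEquality)
open import Relation.Binary.PropositionalEquality
open import Relation.Nullary using (Dec; yes; no; ¬_)
open import Relation.Nullary.Decidable using (¬?; _×-dec_; decidable-stable)
open import Relation.Unary using (Pred; Decidable)

open CommutativeSemigroupProperties +-commutativeSemigroup using (interchange; x∙yz≈y∙xz; xy∙z≈xz∙y)

-- Counting over lists

𝟙 : ∀ {p} {P : Set p} → Dec P → ℕ
𝟙 (yes _) = 1
𝟙 (no _)  = 0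

∑ : ∀ {a} {A : Set a} → List A → (A → ℕ) → ℕ
∑ []       f = 0
∑ (x ∷ xs) f = f x + ∑ xs f

module _ {p r} {P : Set p} {Q : Set r} where

  𝟙-cong : (P? : Dec P) (Q? : Dec Q) → (P → Q) → (Q → P) → 𝟙 P? ≡ 𝟙 Q?
  𝟙-cong (yes _) (yes _) _   _   = refl
  𝟙-cong (yes p) (no ¬q) p⇒q _   = ⊥-elim (¬q (p⇒q p))
  𝟙-cong (no ¬p) (yes q) _   q⇒p = ⊥-elim (¬p (q⇒p q))
  𝟙-cong (no _)  (no _)  _   _   = refl

  𝟙-mono : (P? : Dec P) (Q? : Dec Q) → (P → Q) → 𝟙 P? ≤ 𝟙 Q?
  𝟙-mono (yes p) (no ¬q) p⇒q = ⊥-elim (¬q (p⇒q p))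
  𝟙-mono (yes _) (yes _) _   = ≤-refl
  𝟙-mono (no _)  _       _   = z≤n

  𝟙-< : (P? : Dec P) (Q? : Dec Q) → ¬ P → Q → 𝟙 P? < 𝟙 Q?
  𝟙-< (yes p) _       ¬p _ = ⊥-elim (¬p p)
  𝟙-< (no _)  (no ¬q) _  q = ⊥-elim (¬q q)
  𝟙-< (no _)  (yes _) _  _ = s≤s z≤n

  𝟙-×-dec : (P? : Dec P) (Q? : Dec Q) → 𝟙 (P? ×-dec Q?) ≡ 𝟙 P? * 𝟙 Q?
  𝟙-×-dec (yes _) (yes _) = refl
  𝟙-×-dec (yes _) (no _)  = refl
  𝟙-×-dec (no _)  _       = refl

𝟙-yes : ∀ {p} {P : Set p} (P? : Dec P) → P → 𝟙 P? ≡ 1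
𝟙-yes (yes _) _ = refl
𝟙-yes (no ¬p) p = ⊥-elim (¬p p)

𝟙-¬? : ∀ {p} {P : Set p} (P? : Dec P) → 𝟙 (¬? P?) + 𝟙 P? ≡ 1
𝟙-¬? (yes _) = refl
𝟙-¬? (no _)  = refl

module _ {a} {A : Set a} where

  ∑-cong : ∀ {f g : A → ℕ} xs → (∀ x → f x ≡ g x) → ∑ xs f ≡ ∑ xs g
  ∑-cong []       f≗g = refl
  ∑-cong (x ∷ xs) f≗g = cong₂ _+_ (f≗g x) (∑-cong xs f≗g)

  ∑-congᴬ : ∀ {f g : A → ℕ} {xs} → All (λ x → f x ≡ g x) xs → ∑ xs f ≡ ∑ xs g
  ∑-congᴬ []         = refl
  ∑-congᴬ (e ∷ es) = cong₂ _+_ e (∑-congᴬ es)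

  ∑-+ : ∀ (f g : A → ℕ) xs → ∑ xs (λ x → f x + g x) ≡ ∑ xs f + ∑ xs g
  ∑-+ f g []       = refl
  ∑-+ f g (x ∷ xs) = trans (cong (f x + g x +_) (∑-+ f g xs)) (interchange (f x) (g x) (∑ xs f) (∑ xs g))

  ∑-const : ∀ c (xs : List A) → ∑ xs (λ _ → c) ≡ length xs * c
  ∑-const c []       = refl
  ∑-const c (x ∷ xs) = cong (c +_) (∑-const c xs)

  ∑-1 : ∀ (xs : List A) → ∑ xs (λ _ → 1) ≡ length xs
  ∑-1 xs = trans (∑-const 1 xs) (*-identityʳ (length xs))

  ∑-*ʳ : ∀ c (f : A → ℕ) xs → ∑ xs (λ x → f x * c) ≡ ∑ xs f * c
  ∑-*ʳ c f []       = refl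
  ∑-*ʳ c f (x ∷ xs) = trans (cong (f x * c +_) (∑-*ʳ c f xs)) (sym (*-distribʳ-+ c (f x) (∑ xs f)))

  ∑-mono : ∀ {f g : A → ℕ} {xs} → All (λ x → f x ≤ g x) xs → ∑ xs f ≤ ∑ xs g
  ∑-mono []         = z≤n
  ∑-mono (le ∷ les) = +-mono-≤ le (∑-mono les)

  ∑-< : ∀ {f g : A → ℕ} {xs} → All (λ x → f x ≤ g x) xs → Any (λ x → f x < g x) xs → ∑ xs f < ∑ xs g
  ∑-< (_  ∷ les) (here lt) = +-mono-<-≤ lt (∑-mono les)
  ∑-< (le ∷ les) (there p) = +-mono-≤-< le (∑-< les p)

  ∑-++ : ∀ (f : A → ℕ) xs ys → ∑ (xs ++ ys) f ≡ ∑ xs f + ∑ ys f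
  ∑-++ f []       ys = refl
  ∑-++ f (x ∷ xs) ys = trans (cong (f x +_) (∑-++ f xs ys)) (sym (+-assoc (f x) _ _))

  ∑-filter : ∀ {p} {P : Pred A p} (P? : Decidable P) (f : A → ℕ) xs →
             ∑ xs f ≡ ∑ (filter P? xs) f + ∑ (filter (λ x → ¬? (P? x)) xs) f
  ∑-filter P? f []       = refl
  ∑-filter P? f (x ∷ xs) with P? x
  ... | yes _ = trans (cong (f x +_) (∑-filter P? f xs)) (sym (+-assoc (f x) _ _))
  ... | no  _ = trans (cong (f x +_) (∑-filter P? f xs)) (x∙yz≈y∙xz (f x) (∑ (filter P? xs) f) (∑ (filter (λ x → ¬? (P? x)) xs) f))

  length-filter≡∑𝟙 : ∀ {p} {P : Pred A p} (P? : Decidable P) xs → length (filter P? xs) ≡ ∑ xs (λ x → 𝟙 (P? x))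
  length-filter≡∑𝟙 P? []       = refl
  length-filter≡∑𝟙 P? (x ∷ xs) with P? x
  ... | yes _ = cong suc (length-filter≡∑𝟙 P? xs)
  ... | no  _ = length-filter≡∑𝟙 P? xs

  module _ {p} {P : Pred A p} (P? : Decidable P) where

    Any⇒1≤∑𝟙 : ∀ {xs} → Any P xs → 1 ≤ ∑ xs (λ x → 𝟙 (P? x))
    Any⇒1≤∑𝟙 {x ∷ _} (here px) = ≤-trans (𝟙-mono (yes px) (P? x) id) (m≤m+n _ _)
    Any⇒1≤∑𝟙 {x ∷ _} (there p) = ≤-trans (Any⇒1≤∑𝟙 p) (m≤n+m _ _)

    1≤∑𝟙⇒Any : ∀ xs → 1 ≤ ∑ xs (λ x → 𝟙 (P? x)) → Any P xs
    1≤∑𝟙⇒Any (x ∷ xs) h with P? x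
    ... | yes px = here px
    ... | no  _  = there (1≤∑𝟙⇒Any xs h)

    All¬⇒∑𝟙≡0 : ∀ {xs} → All (λ x → ¬ P x) xs → ∑ xs (λ x → 𝟙 (P? x)) ≡ 0
    All¬⇒∑𝟙≡0 []                  = refl
    All¬⇒∑𝟙≡0 {x ∷ _} (¬px ∷ ¬ps) with P? x
    ... | yes px = ⊥-elim (¬px px)
    ... | no  _  = All¬⇒∑𝟙≡0 ¬ps

    minimiser : (f : A → ℕ) → ∀ {xs} → Any P xs → ∃ λ x → x ∈ xs × P x × All (λ y → P y → f x ≤ f y) xs
    minimiser f {x ∷ xs} p with any? P? xs
    ... | no ¬p = x , here refl , Any.head ¬p p , (λ _ → ≤-refl) ∷ All.map (λ ¬py py → ⊥-elim (¬py py)) (¬Any⇒All¬ xs ¬p)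
    ... | yes p′ with minimiser f p′
    ...   | y , y∈xs , py , y-min with P? x
    ...     | no ¬px = y , there y∈xs , py , (λ px → ⊥-elim (¬px px)) ∷ y-min
    ...     | yes px with f x ≤? f y
    ...       | yes fx≤fy = x , here refl , px , (λ _ → ≤-refl) ∷ All.map (λ h pz → ≤-trans fx≤fy (h pz)) y-min
    ...       | no  fx≰fy = y , there y∈xs , py , (λ _ → ≰⇒≥ fx≰fy) ∷ y-min

  ∑𝟙-≟-unique : (_≟ᴬ_ : DecidableEquality A) → ∀ {xs} → Unique xs → ∀ {v} → v ∈ xs → ∑ xs (λ x → 𝟙 (x ≟ᴬ v)) ≡ 1
  ∑𝟙-≟-unique _≟ᴬ_ {x ∷ xs} (x≢xs ∷ xs-unique) {v} v∈ with x ≟ᴬ v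
  ... | yes refl = cong suc (All¬⇒∑𝟙≡0 (_≟ᴬ v) (All.map (λ x≢y y≡x → x≢y (sym y≡x)) x≢xs))
  ... | no  x≢v  = ∑𝟙-≟-unique _≟ᴬ_ xs-unique (Any.tail (λ v≡x → x≢v (sym v≡x)) v∈)

  length*suc≤∑+count : ∀ (f : A → ℕ) d {xs} → All (λ x → d ≤ f x) xs →
                       length xs * suc d ≤ ∑ xs f + ∑ xs (λ x → 𝟙 (f x ≟ d))
  length*suc≤∑+count f d {xs} d≤f = begin
    length xs * suc d                          ≡⟨ ∑-const (suc d) xs ⟨
    ∑ xs (λ _ → suc d)                         ≤⟨ ∑-mono (All.map ≤+𝟙≟ d≤f) ⟩
    ∑ xs (λ x → f x + 𝟙 (f x ≟ d))             ≡⟨ ∑-+ f _ xs ⟩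
    ∑ xs f + ∑ xs (λ x → 𝟙 (f x ≟ d))          ∎
    where
    open ≤-Reasoning
    ≤+𝟙≟ : ∀ {m} → d ≤ m → suc d ≤ m + 𝟙 (m ≟ d)
    ≤+𝟙≟ {m} d≤m with m ≟ d
    ... | yes refl = ≤-reflexive (+-comm 1 d)
    ... | no  m≢d  = ≤-trans (≤∧≢⇒< d≤m (m≢d ∘ sym)) (m≤m+n m 0)

  ∑≤length*⇒all≡ : ∀ (f : A → ℕ) d {xs} → All (λ x → d ≤ f x) xs → ∑ xs f ≤ length xs * d → All (λ x → f x ≡ d) xs
  ∑≤length*⇒all≡ f d []                 _  = []
  ∑≤length*⇒all≡ f d {x ∷ xs} (d≤fx ∷ d≤f) le = ≤-antisym fx≤d d≤fx ∷ ∑≤length*⇒all≡ f d d≤f ∑≤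
    where
    length*≤∑ : length xs * d ≤ ∑ xs f
    length*≤∑ = ≤-trans (≤-reflexive (sym (∑-const d xs))) (∑-mono d≤f)
    fx≤d : f x ≤ d
    fx≤d = +-cancelʳ-≤ (∑ xs f) (f x) d (≤-trans le (+-monoʳ-≤ d length*≤∑))
    ∑≤ : ∑ xs f ≤ length xs * d
    ∑≤ = +-cancelˡ-≤ d _ _ (≤-trans (+-monoˡ-≤ (∑ xs f) d≤fx) le)

∑-map : ∀ {a b} {A : Set a} {B : Set b} (f : B → ℕ) (g : A → B) xs → ∑ (map g xs) f ≡ ∑ xs (f ∘ g)
∑-map f g []       = refl
∑-map f g (x ∷ xs) = cong (f (g x) +_) (∑-map f g xs)

∑-concatMap : ∀ {a b} {A : Set a} {B : Set b} (f : B → ℕ) (g : A → List B) xs →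
              ∑ (concatMap g xs) f ≡ ∑ xs (λ x → ∑ (g x) f)
∑-concatMap f g []       = refl
∑-concatMap f g (x ∷ xs) = trans (∑-++ f (g x) (concatMap g xs)) (cong (∑ (g x) f +_) (∑-concatMap f g xs))

∑-swap : ∀ {a b} {A : Set a} {B : Set b} (f : A → B → ℕ) xs ys →
         ∑ xs (λ x → ∑ ys (f x)) ≡ ∑ ys (λ y → ∑ xs (λ x → f x y))
∑-swap f []       ys = sym (trans (∑-const 0 ys) (*-zeroʳ (length ys)))
∑-swap f (x ∷ xs) ys = trans (cong (∑ ys (f x) +_) (∑-swap f xs ys)) (sym (∑-+ (f x) _ ys))

Any⇒0<length : ∀ {a p} {A : Set a} {P : Pred A p} {xs} → Any P xs → 0 < length xs
Any⇒0<length (here _)  = s≤s z≤n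
Any⇒0<length (there _) = s≤s z≤n

map-≡⇒All : ∀ {a b} {A : Set a} {B : Set b} {f g : A → B} xs → map f xs ≡ map g xs → All (λ x → f x ≡ g x) xs
map-≡⇒All []       _  = []
map-≡⇒All (x ∷ xs) eq = ∷-injectiveˡ eq ∷ map-≡⇒All xs (∷-injectiveʳ eq)
  where open import Data.List.Properties using (∷-injectiveˡ; ∷-injectiveʳ)

-- Ceiling division and the Griesmer function

⌈m/q⌉≤n⇒m≤n*q : ∀ m n q .{{_ : NonZero q}} → ceilDiv m q ≤ n → m ≤ n * q
⌈m/q⌉≤n⇒m≤n*q m n (suc b) h = +-cancelʳ-≤ b m (n * suc b) (begin
  m + b                                     ≡⟨ m≡m%n+[m/n]*n (m + b) (suc b) ⟩
  (m + b) % suc b + (m + b) / suc b * suc b ≤⟨ +-mono-≤ (m<1+n⇒m≤n (m%n<n (m + b) (suc b))) (*-monoˡ-≤ (suc b) h) ⟩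
  b + n * suc b                             ≡⟨ +-comm b _ ⟩
  n * suc b + b                             ∎)
  where open ≤-Reasoning

m≤n*q⇒⌈m/q⌉≤n : ∀ m n q .{{_ : NonZero q}} → m ≤ n * q → ceilDiv m q ≤ n
m≤n*q⇒⌈m/q⌉≤n m n (suc b) h = m<1+n⇒m≤n (m<n*o⇒m/o<n (begin-strict
  m + b             ≤⟨ +-monoˡ-≤ b h ⟩
  n * suc b + b     <⟨ +-monoʳ-< (n * suc b) (n<1+n b) ⟩
  n * suc b + suc b ≡⟨ +-comm (n * suc b) _ ⟩
  suc n * suc b     ∎))
  where open ≤-Reasoning

⌈m/q⌉*q<m+q : ∀ m q .{{_ : NonZero q}} → ceilDiv m q * q < m + q
⌈m/q⌉*q<m+q m (suc b) = ≤-trans (s≤s (m/n*n≤m (m + b) (suc b))) (≤-reflexive (sym (+-suc m b)))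

⌈m/q⌉-mono-≤ : ∀ q .{{_ : NonZero q}} {m n} → m ≤ n → ceilDiv m q ≤ ceilDiv n q
⌈m/q⌉-mono-≤ q {m} {n} m≤n = m≤n*q⇒⌈m/q⌉≤n m _ q (≤-trans m≤n (⌈m/q⌉≤n⇒m≤n*q n _ q ≤-refl))

⌈m*q/q⌉≡m : ∀ m q .{{_ : NonZero q}} → ceilDiv (m * q) q ≡ m
⌈m*q/q⌉≡m m q = ≤-antisym (m≤n*q⇒⌈m/q⌉≤n (m * q) m q ≤-refl)
                          (*-cancelʳ-≤ m _ q (⌈m/q⌉≤n⇒m≤n*q (m * q) _ q ≤-refl))

⌈m/1⌉≡m : ∀ m → ceilDiv m 1 ≡ m
⌈m/1⌉≡m m = trans (cong (_/ 1) (+-identityʳ m)) (n/1≡n m)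

⌈⌈m/p⌉/q⌉≡⌈m/p*q⌉ : ∀ m p q .{{p≢0 : NonZero p}} .{{q≢0 : NonZero q}} → ceilDiv (ceilDiv m p) q ≡ ceilDiv m (p * q)
⌈⌈m/p⌉/q⌉≡⌈m/p*q⌉ m p q = ≤-antisym
  (m≤n*q⇒⌈m/q⌉≤n _ r q (m≤n*q⇒⌈m/q⌉≤n m _ p (begin
    m             ≤⟨ ⌈m/q⌉≤n⇒m≤n*q m r (p * q) {{m*n≢0 p q}} ≤-refl ⟩
    r * (p * q)   ≡⟨ cong (r *_) (*-comm p q) ⟩
    r * (q * p)   ≡⟨ *-assoc r q p ⟨
    r * q * p     ∎)))
  (m≤n*q⇒⌈m/q⌉≤n m s (p * q) {{m*n≢0 p q}} (begin
    m             ≤⟨ ⌈m/q⌉≤n⇒m≤n*q m _ p ≤-refl ⟩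
    ceilDiv m p * p ≤⟨ *-monoˡ-≤ p (⌈m/q⌉≤n⇒m≤n*q (ceilDiv m p) s q ≤-refl) ⟩
    s * q * p     ≡⟨ *-assoc s q p ⟩
    s * (q * p)   ≡⟨ cong (s *_) (*-comm q p) ⟩
    s * (p * q)   ∎))
  where
  open ≤-Reasoning
  r = ceilDiv m (p * q)
  s = ceilDiv (ceilDiv m p) q

module _ (q : ℕ) .{{_ : NonZero q}} where

  griesmer-suc : ∀ k d → griesmer q (suc k) d ≡ d + griesmer q k (ceilDiv d q)
  griesmer-suc zero    d = trans (⌈m/1⌉≡m d) (sym (+-identityʳ d))
  griesmer-suc (suc k) d = begin
    griesmer q (suc k) d + ceilDiv d (q * q ^ k)     ≡⟨ cong₂ _+_ (griesmer-suc k d) (sym (⌈⌈m/p⌉/q⌉≡⌈m/p*q⌉ d q (q ^ k) {{q≢0 = m^n≢0 q k}})) ⟩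
    d + griesmer q k u + ceilDiv u (q ^ k)           ≡⟨ +-assoc d _ _ ⟩
    d + (griesmer q k u + ceilDiv u (q ^ k))         ∎
    where
    open ≡-Reasoning
    u = ceilDiv d q

  griesmer-mono : ∀ k {m n} → m ≤ n → griesmer q k m ≤ griesmer q k n
  griesmer-mono zero    _   = z≤n
  griesmer-mono (suc k) m≤n = +-mono-≤ (griesmer-mono k m≤n) (⌈m/q⌉-mono-≤ (q ^ k) {{m^n≢0 q k}} m≤n)

  griesmer-< : ∀ k m → griesmer q (suc k) m < griesmer q (suc k) (suc m)
  griesmer-< k m = begin-strict
    griesmer q (suc k) m                         ≡⟨ griesmer-suc k m ⟩
    m + griesmer q k (ceilDiv m q)               <⟨ +-monoˡ-< _ (n<1+n m) ⟩
    suc m + griesmer q k (ceilDiv m q)           ≤⟨ +-monoʳ-≤ (suc m) (griesmer-mono k (⌈m/q⌉-mono-≤ q (n≤1+n m))) ⟩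
    suc m + griesmer q k (ceilDiv (suc m) q)     ≡⟨ griesmer-suc k (suc m) ⟨
    griesmer q (suc k) (suc m)                   ∎
    where open ≤-Reasoning

  griesmer-cancel-≤ : ∀ k {m n} → 0 < griesmer q k n → griesmer q k m ≤ griesmer q k n → m ≤ n
  griesmer-cancel-≤ zero    ()
  griesmer-cancel-≤ (suc k) {m} {n} _ le with m ≤? n
  ... | yes m≤n = m≤n
  ... | no  m≰n = ⊥-elim (<⇒≱ (griesmer-< k n) (≤-trans (griesmer-mono (suc k) (≰⇒> m≰n)) le))

-- Linear codes over a finite field

module CodeTheory (F : FiniteField) where
  open FiniteField F using (isCommutativeRing; _≟F_; elements; elements-unique; elements-complete; inverse; 0≢1; q)
  open Code F

  commutativeRing : CommutativeRing _ _
  commutativeRing = record { isCommutativeRing = isCommutativeRing }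

  private
    module R = CommutativeRing commutativeRing
    module Σᶠ = SemiringSum R.semiring
  open R using (Carrier; 0#; 1#) renaming (_+_ to _+ᶠ_; _*_ to _*ᶠ_; -_ to -ᶠ_)
  open GroupProperties R.+-group using (∙-cancelˡ; inverseʳ-unique; //-rightDividesˡ)
  open RingProperties R.ring using (-‿distribˡ-*)

  instance
    q≢0 : NonZero q
    q≢0 = >-nonZero (Any⇒0<length (elements-complete 0#))

  *-cancelʳ-≢0 : ∀ {x} → x ≢ 0# → ∀ {l m} → l *ᶠ x ≡ m *ᶠ x → l ≡ m
  *-cancelʳ-≢0 {x} x≢0 {l} {m} lx≡mx with inverse x x≢0
  ... | y , xy≡1 = begin
    l             ≡⟨ ·x·y≡ l ⟨
    l *ᶠ x *ᶠ y   ≡⟨ cong (_*ᶠ y) lx≡mx ⟩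
    m *ᶠ x *ᶠ y   ≡⟨ ·x·y≡ m ⟩
    m             ∎
    where
    open ≡-Reasoning
    ·x·y≡ : ∀ z → z *ᶠ x *ᶠ y ≡ z
    ·x·y≡ z = trans (R.*-assoc z x y) (trans (cong (z *ᶠ_) xy≡1) (R.*-identityʳ z))

  x+[-l]*y≡z⇒x≡l*y+z : ∀ x l y {z} → x +ᶠ (-ᶠ l) *ᶠ y ≡ z → x ≡ l *ᶠ y +ᶠ z
  x+[-l]*y≡z⇒x≡l*y+z x l y {z} eq = begin
    x                              ≡⟨ //-rightDividesˡ (l *ᶠ y) x ⟨
    x +ᶠ -ᶠ (l *ᶠ y) +ᶠ l *ᶠ y     ≡⟨ cong (λ w → x +ᶠ w +ᶠ l *ᶠ y) (-‿distribˡ-* l y) ⟩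
    x +ᶠ (-ᶠ l) *ᶠ y +ᶠ l *ᶠ y     ≡⟨ cong (_+ᶠ l *ᶠ y) eq ⟩
    z +ᶠ l *ᶠ y                    ≡⟨ R.+-comm z _ ⟩
    l *ᶠ y +ᶠ z                    ∎
    where open ≡-Reasoning

  x+[-l]*y≡0⇒x≡l*y : ∀ x l y → x +ᶠ (-ᶠ l) *ᶠ y ≡ 0# → x ≡ l *ᶠ y
  x+[-l]*y≡0⇒x≡l*y x l y eq = trans (x+[-l]*y≡z⇒x≡l*y+z x l y eq) (R.+-identityʳ _)

  l*y≡x⇒x+[-l]*y≡0 : ∀ x l y → l *ᶠ y ≡ x → x +ᶠ (-ᶠ l) *ᶠ y ≡ 0#
  l*y≡x⇒x+[-l]*y≡0 x l y eq =
    trans (cong (x +ᶠ_) (sym (-‿distribˡ-* l y))) (trans (cong (λ w → x +ᶠ -ᶠ w) eq) (R.-‿inverseʳ x))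

  ∑𝟙-root : ∀ c {x} → x ≢ 0# → ∑ elements (λ l → 𝟙 ((c +ᶠ l *ᶠ x) ≟F 0#)) ≡ 1
  ∑𝟙-root c {x} x≢0 with inverse x x≢0
  ... | y , xy≡1 = trans (∑-cong elements (λ l → 𝟙-cong ((c +ᶠ l *ᶠ x) ≟F 0#) (l ≟F l₀) root⇒≡l₀ ≡l₀⇒root))
                         (∑𝟙-≟-unique _≟F_ elements-unique (elements-complete l₀))
    where
    l₀ = (-ᶠ c) *ᶠ y
    l₀x≡-c : l₀ *ᶠ x ≡ -ᶠ c
    l₀x≡-c = trans (R.*-assoc _ y x) (trans (cong ((-ᶠ c) *ᶠ_) (trans (R.*-comm y x) xy≡1)) (R.*-identityʳ _))
    root⇒≡l₀ : ∀ {l} → c +ᶠ l *ᶠ x ≡ 0# → l ≡ l₀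
    root⇒≡l₀ eq = *-cancelʳ-≢0 x≢0 (trans (inverseʳ-unique c _ eq) (sym l₀x≡-c))
    ≡l₀⇒root : ∀ {l} → l ≡ l₀ → c +ᶠ l *ᶠ x ≡ 0#
    ≡l₀⇒root refl = trans (cong (c +ᶠ_) l₀x≡-c) (R.-‿inverseʳ c)

  infixl 6 _+ᵐ_·ᵐ_
  _+ᵐ_·ᵐ_ : ∀ {k} → (Fin k → Carrier) → Carrier → (Fin k → Carrier) → Fin k → Carrier
  (μ +ᵐ l ·ᵐ m) i = μ i +ᶠ l *ᶠ m i

  0ᵐ : ∀ {k} → Fin k → Carrier
  0ᵐ _ = 0#

  +ᵐ0·ᵐ : ∀ {k} (μ m : Fin k → Carrier) → μ +ᵐ 0# ·ᵐ m ≗ μ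
  +ᵐ0·ᵐ μ m i = trans (cong (μ i +ᶠ_) (R.zeroˡ (m i))) (R.+-identityʳ (μ i))

  encode≡sum : ∀ {k n} (G : GenMatrix k n) m j → encode G m j ≡ Σᶠ.sum (λ i → m i *ᶠ G i j)
  encode≡sum {k} G m j = foldr-tabulate id
    where
    foldr-tabulate : ∀ {k′} (h : Fin k′ → Fin k) →
                     foldr (λ i acc → m i *ᶠ G i j +ᶠ acc) 0# (tabulate h) ≡ Σᶠ.sum (λ i → m (h i) *ᶠ G (h i) j)
    foldr-tabulate {zero}  h = refl
    foldr-tabulate {suc _} h = cong (m (h zero) *ᶠ G (h zero) j +ᶠ_) (foldr-tabulate (h ∘ suc))

  module _ {k n} (G : GenMatrix k n) where

    encode-+· : ∀ μ l m j → encode G (μ +ᵐ l ·ᵐ m) j ≡ encode G μ j +ᶠ l *ᶠ encode G m j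
    encode-+· μ l m j = begin
      encode G (μ +ᵐ l ·ᵐ m) j                                               ≡⟨ encode≡sum G _ j ⟩
      Σᶠ.sum (λ i → (μ i +ᶠ l *ᶠ m i) *ᶠ G i j)                              ≡⟨ Σᶠ.sum-cong-≗ (λ i → distrib (μ i) l (m i) (G i j)) ⟩
      Σᶠ.sum (λ i → μ i *ᶠ G i j +ᶠ l *ᶠ (m i *ᶠ G i j))                     ≡⟨ Σᶠ.∑-distrib-+ (λ i → μ i *ᶠ G i j) (λ i → l *ᶠ (m i *ᶠ G i j)) ⟩
      Σᶠ.sum (λ i → μ i *ᶠ G i j) +ᶠ Σᶠ.sum (λ i → l *ᶠ (m i *ᶠ G i j))      ≡⟨ cong₂ _+ᶠ_ (encode≡sum G μ j) (Σᶠ.*-distribˡ-sum l (λ i → m i *ᶠ G i j)) ⟨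
      encode G μ j +ᶠ l *ᶠ Σᶠ.sum (λ i → m i *ᶠ G i j)                       ≡⟨ cong (λ s → encode G μ j +ᶠ l *ᶠ s) (encode≡sum G m j) ⟨
      encode G μ j +ᶠ l *ᶠ encode G m j                                      ∎
      where
      open ≡-Reasoning
      distrib : ∀ u l v g → (u +ᶠ l *ᶠ v) *ᶠ g ≡ u *ᶠ g +ᶠ l *ᶠ (v *ᶠ g)
      distrib u l v g = trans (R.distribʳ g u (l *ᶠ v)) (cong (u *ᶠ g +ᶠ_) (R.*-assoc l v g))

    encode-cong : ∀ {m m′} → m ≗ m′ → encode G m ≗ encode G m′
    encode-cong {m} {m′} m≗m′ j = begin
      encode G m j                      ≡⟨ encode≡sum G m j ⟩
      Σᶠ.sum (λ i → m i *ᶠ G i j)       ≡⟨ Σᶠ.sum-cong-≗ (λ i → cong (_*ᶠ G i j) (m≗m′ i)) ⟩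
      Σᶠ.sum (λ i → m′ i *ᶠ G i j)      ≡⟨ encode≡sum G m′ j ⟨
      encode G m′ j                     ∎
      where open ≡-Reasoning

    encode-0 : ∀ {m} → m ≗ 0ᵐ → encode G m ≗ 0ᵐ
    encode-0 {m} m≗0 j = begin
      encode G m j                      ≡⟨ encode≡sum G m j ⟩
      Σᶠ.sum (λ i → m i *ᶠ G i j)       ≡⟨ Σᶠ.sum-cong-≗ (λ i → trans (cong (_*ᶠ G i j) (m≗0 i)) (R.zeroˡ _)) ⟩
      Σᶠ.sum {k} 0ᵐ                     ≡⟨ Σᶠ.sum-replicate-zero k ⟩
      0#                                ∎
      where open ≡-Reasoning

  encode-insertAt : ∀ {k n} (G : GenMatrix (suc k) n) i μ → encode G (insertAt μ i 0#) ≗ encode (removeAt G i) μ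
  encode-insertAt G i μ j = begin
    encode G (insertAt μ i 0#) j                         ≡⟨ encode≡sum G _ j ⟩
    Σᶠ.sum t                                             ≡⟨ Σᶠ.sum-remove {i = i} t ⟩
    t i +ᶠ Σᶠ.sum (removeAt t i)                         ≡⟨ cong₂ _+ᶠ_ tᵢ≡0 (Σᶠ.sum-cong-≗ (λ l → cong (_*ᶠ G (punchIn i l) j) (insertAt-punchIn μ i 0# l))) ⟩
    0# +ᶠ Σᶠ.sum (λ l → μ l *ᶠ removeAt G i l j)         ≡⟨ R.+-identityˡ _ ⟩
    Σᶠ.sum (λ l → μ l *ᶠ removeAt G i l j)               ≡⟨ encode≡sum (removeAt G i) μ j ⟨
    encode (removeAt G i) μ j                            ∎
    where
    open ≡-Reasoning
    t = λ l → insertAt μ i 0# l *ᶠ G l j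
    tᵢ≡0 : t i ≡ 0#
    tᵢ≡0 = trans (cong (_*ᶠ G i j) (insertAt-lookup μ i 0#)) (R.zeroˡ _)

  infix 4 _≗?_
  _≗?_ : ∀ {k} (m v : Fin k → Carrier) → Dec (m ≗ v)
  _≗?_ {zero}  m v = yes λ ()
  _≗?_ {suc k} m v with m zero ≟F v zero | (m ∘ suc) ≗? (v ∘ suc)
  ... | yes m₀≡v₀ | yes m≗v = yes λ { zero → m₀≡v₀ ; (suc i) → m≗v i }
  ... | no  m₀≢v₀ | _       = no λ m≗v → m₀≢v₀ (m≗v zero)
  ... | yes _     | no ¬m≗v = no λ m≗v → ¬m≗v (m≗v ∘ suc)

  𝟙-≗?-suc : ∀ {k} (m v : Fin (suc k) → Carrier) → 𝟙 (m ≗? v) ≡ 𝟙 ((m ∘ suc) ≗? (v ∘ suc)) * 𝟙 (m zero ≟F v zero)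
  𝟙-≗?-suc m v with m zero ≟F v zero | (m ∘ suc) ≗? (v ∘ suc)
  ... | yes _ | yes _ = refl
  ... | yes _ | no  _ = refl
  ... | no  _ | yes _ = refl
  ... | no  _ | no  _ = refl

  ∑-messages-≗ : ∀ k (v : Fin k → Carrier) → ∑ (messages k) (λ m → 𝟙 (m ≗? v)) ≡ 1
  ∑-messages-≗ zero    v = refl
  ∑-messages-≗ (suc k) v = begin
    ∑ (messages (suc k)) (λ m → 𝟙 (m ≗? v))
      ≡⟨ trans (∑-concatMap _ _ elements) (∑-cong elements λ x → trans (∑-map _ _ (messages k))
                                                               (∑-cong (messages k) λ m → 𝟙-≗?-suc _ v)) ⟩
    ∑ elements (λ x → ∑ (messages k) (λ m → 𝟙 (m ≗? v ∘ suc) * 𝟙 (x ≟F v zero)))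
      ≡⟨ ∑-cong elements (λ x → ∑-*ʳ (𝟙 (x ≟F v zero)) _ (messages k)) ⟩
    ∑ elements (λ x → ∑ (messages k) (λ m → 𝟙 (m ≗? v ∘ suc)) * 𝟙 (x ≟F v zero))
      ≡⟨ ∑-cong elements (λ x → trans (cong (_* 𝟙 (x ≟F v zero)) (∑-messages-≗ k (v ∘ suc))) (*-identityˡ _)) ⟩
    ∑ elements (λ x → 𝟙 (x ≟F v zero))
      ≡⟨ ∑𝟙-≟-unique _≟F_ elements-unique (elements-complete (v zero)) ⟩
    1 ∎
    where open ≡-Reasoning

  ∈-messages : ∀ k (v : Fin k → Carrier) → ∃ λ m → m ∈ messages k × m ≗ v
  ∈-messages k v = find (1≤∑𝟙⇒Any (_≗? v) (messages k) (≤-reflexive (sym (∑-messages-≗ k v))))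

  wtOn : ∀ {n} → List (Fin n) → Word n → ℕ
  wtOn L w = ∑ L (λ j → 𝟙 (¬? (w j ≟F 0#)))

  NonzeroOn : ∀ {n} → List (Fin n) → Word n → Set
  NonzeroOn L w = Any (λ j → w j ≢ 0#) L

  NonzeroOn? : ∀ {n} L (w : Word n) → Dec (NonzeroOn L w)
  NonzeroOn? L w = any? (λ j → ¬? (w j ≟F 0#)) L

  listWt-map : ∀ {n} (w : Word n) L → listWt (map w L) ≡ wtOn L w
  listWt-map w L = trans (length-filter≡∑𝟙 (λ x → ¬? (x ≟F 0#)) (map w L)) (∑-map _ w L)

  wt-cong : ∀ {n} {w w′ : Word n} → w ≗ w′ → wt w ≡ wt w′
  wt-cong w≗w′ = cong listWt (map-cong w≗w′ (allFin _))

  NonzeroOn-cong : ∀ {n} {L : List (Fin n)} {w w′ : Word n} → All (λ j → w j ≡ w′ j) L → NonzeroOn L w → NonzeroOn L w′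
  NonzeroOn-cong (e ∷ _)  (here wj≢0) = here (λ w′j≡0 → wj≢0 (trans e w′j≡0))
  NonzeroOn-cong (_ ∷ es) (there nz)  = there (NonzeroOn-cong es nz)

  module _ {n} {L : List (Fin n)} where

    wtOn-cong : ∀ {w w′ : Word n} → All (λ j → w j ≡ w′ j) L → wtOn L w ≡ wtOn L w′
    wtOn-cong = ∑-congᴬ ∘ All.map (cong (λ x → 𝟙 (¬? (x ≟F 0#))))

    ¬NonzeroOn⇒zero : ∀ {w : Word n} → ¬ NonzeroOn L w → All (λ j → w j ≡ 0#) L
    ¬NonzeroOn⇒zero {w} ¬nz = All.map (λ {j} → decidable-stable (w j ≟F 0#)) (¬Any⇒All¬ L ¬nz)

    NonzeroOn⇒0<wtOn : ∀ {w : Word n} → NonzeroOn L w → 0 < wtOn L w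
    NonzeroOn⇒0<wtOn {w} = Any⇒1≤∑𝟙 (λ j → ¬? (w j ≟F 0#))

    0<wtOn⇒NonzeroOn : ∀ {w : Word n} → 0 < wtOn L w → NonzeroOn L w
    0<wtOn⇒NonzeroOn {w} = 1≤∑𝟙⇒Any (λ j → ¬? (w j ≟F 0#)) L

  nonzero-encoding⇒nonzero-message : ∀ {k n} (G : GenMatrix k n) L m →
                                     NonzeroOn L (encode G m) → ∃ λ i → m i ≢ 0#
  nonzero-encoding⇒nonzero-message {k} G L m nz = ¬∀⟶∃¬ k _ (λ i → m i ≟F 0#) λ m≗0 →
    let (j , _ , mGj≢0) = find nz in mGj≢0 (encode-0 G m≗0 j)

  offSupp supp : ∀ {n} → Word n → List (Fin n) → List (Fin n)
  offSupp a L = filter (λ j → a j ≟F 0#) L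
  supp    a L = filter (λ j → ¬? (a j ≟F 0#)) L

  length-supp : ∀ {n} (a : Word n) L → length (supp a L) ≡ wtOn L a
  length-supp a L = length-filter≡∑𝟙 (λ j → ¬? (a j ≟F 0#)) L

  length-offSupp : ∀ {n} (a : Word n) L → length L ≡ length (offSupp a L) + wtOn L a
  length-offSupp a L = begin
    length L                                                ≡⟨ ∑-1 L ⟨
    ∑ L (λ _ → 1)                                           ≡⟨ ∑-filter (λ j → a j ≟F 0#) _ L ⟩
    ∑ (offSupp a L) (λ _ → 1) + ∑ (supp a L) (λ _ → 1)      ≡⟨ cong₂ _+_ (∑-1 (offSupp a L)) (trans (∑-1 (supp a L)) (length-supp a L)) ⟩
    length (offSupp a L) + wtOn L a                         ∎
    where open ≡-Reasoning

  wtOn-split : ∀ {n} (a w : Word n) L → wtOn L w ≡ wtOn (offSupp a L) w + wtOn (supp a L) w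
  wtOn-split a w L = ∑-filter (λ j → a j ≟F 0#) _ L

  -- On supp(a) every coordinate of c + λa vanishes for exactly one λ.
  ∑-wtOn-supp-line : ∀ {n} (a c : Word n) L →
                     ∑ elements (λ l → wtOn (supp a L) (λ j → c j +ᶠ l *ᶠ a j)) + wtOn L a ≡ q * wtOn L a
  ∑-wtOn-supp-line {n} a c L = begin
    ∑ elements (λ l → ∑ T (nonzeroAt l)) + wtOn L a                    ≡⟨ cong₂ _+_ (∑-swap nonzeroAt elements T) (sym (trans (∑-1 T) (length-supp a L))) ⟩
    ∑ T (λ j → ∑ elements (λ l → nonzeroAt l j)) + ∑ T (λ _ → 1)       ≡⟨ ∑-+ _ _ T ⟨
    ∑ T (λ j → ∑ elements (λ l → nonzeroAt l j) + 1)                   ≡⟨ ∑-congᴬ (All.map nonzero-for-all-but-one (all-filter _ L)) ⟩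
    ∑ T (λ _ → q)                                                      ≡⟨ ∑-const q T ⟩
    length T * q                                                       ≡⟨ cong (_* q) (length-supp a L) ⟩
    wtOn L a * q                                                       ≡⟨ *-comm _ q ⟩
    q * wtOn L a                                                       ∎
    where
    open ≡-Reasoning
    T = supp a L
    nonzeroAt : Carrier → Fin n → ℕ
    nonzeroAt l j = 𝟙 (¬? ((c j +ᶠ l *ᶠ a j) ≟F 0#))
    nonzero-for-all-but-one : ∀ {j} → a j ≢ 0# → ∑ elements (λ l → nonzeroAt l j) + 1 ≡ q
    nonzero-for-all-but-one {j} aj≢0 = begin
      ∑ elements (λ l → nonzeroAt l j) + 1                                               ≡⟨ cong (∑ elements (λ l → nonzeroAt l j) +_) (∑𝟙-root (c j) aj≢0) ⟨
      ∑ elements (λ l → nonzeroAt l j) + ∑ elements (λ l → 𝟙 ((c j +ᶠ l *ᶠ a j) ≟F 0#))  ≡⟨ ∑-+ _ _ elements ⟨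
      ∑ elements (λ l → nonzeroAt l j + 𝟙 ((c j +ᶠ l *ᶠ a j) ≟F 0#))                     ≡⟨ ∑-cong elements (λ l → 𝟙-¬? ((c j +ᶠ l *ᶠ a j) ≟F 0#)) ⟩
      ∑ elements (λ _ → 1)                                                               ≡⟨ ∑-1 elements ⟩
      q                                                                                  ∎

  LinIndepOn : ∀ {k n} → List (Fin n) → GenMatrix k n → Set
  LinIndepOn {k} L G = ∀ (m : Fin k → Carrier) → All (λ j → encode G m j ≡ 0#) L → ∀ i → m i ≡ 0#

  MinWtAtLeast : ∀ {k n} → List (Fin n) → GenMatrix k n → ℕ → Set
  MinWtAtLeast {k} L G D = ∀ (m : Fin k → Carrier) → NonzeroOn L (encode G m) → D ≤ wtOn L (encode G m)

  module _ {k n} {L : List (Fin n)} {G : GenMatrix k n} where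

    encode-injectiveOn : LinIndepOn L G → ∀ {μ ν} → All (λ j → encode G μ j ≡ encode G ν j) L → μ ≗ ν
    encode-injectiveOn indep {μ} {ν} μG≡νG i =
      trans (x+[-l]*y≡0⇒x≡l*y (μ i) 1# (ν i) (indep (μ +ᵐ -ᶠ 1# ·ᵐ ν) δG≡0 i)) (R.*-identityˡ (ν i))
      where
      δG≡0 : All (λ j → encode G (μ +ᵐ -ᶠ 1# ·ᵐ ν) j ≡ 0#) L
      δG≡0 = All.map (λ {j} e → trans (encode-+· G μ (-ᶠ 1#) ν j)
                                      (l*y≡x⇒x+[-l]*y≡0 _ 1# _ (trans (R.*-identityˡ _) (sym e)))) μG≡νG

    lighter⇒zero : ∀ {D} → MinWtAtLeast L G D → ∀ m → wtOn L (encode G m) < D → All (λ j → encode G m j ≡ 0#) L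
    lighter⇒zero D-min m lighter = ¬NonzeroOn⇒zero (λ nz → <⇒≱ lighter (D-min m nz))

  -- Puncturing along a codeword of minimum weight

  module Puncturing {k n} (G : GenMatrix k n) (L : List (Fin n)) (ma : Fin k → Carrier) (a : Word n)
                    (ma↦a : encode G ma ≗ a) (a-min : MinWtAtLeast L G (wtOn L a)) where

    encode-line : ∀ μ l j → encode G (μ +ᵐ l ·ᵐ ma) j ≡ encode G μ j +ᶠ l *ᶠ a j
    encode-line μ l j = trans (encode-+· G μ l ma j) (cong (λ x → encode G μ j +ᶠ l *ᶠ x) (ma↦a j))

    encode-line-offSupp : ∀ μ l → All (λ j → encode G (μ +ᵐ l ·ᵐ ma) j ≡ encode G μ j) (offSupp a L)
    encode-line-offSupp μ l = All.map (λ {j} aj≡0 → begin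
      encode G (μ +ᵐ l ·ᵐ ma) j    ≡⟨ encode-line μ l j ⟩
      encode G μ j +ᶠ l *ᶠ a j     ≡⟨ cong (λ x → encode G μ j +ᶠ l *ᶠ x) aj≡0 ⟩
      encode G μ j +ᶠ l *ᶠ 0#      ≡⟨ cong (encode G μ j +ᶠ_) (R.zeroʳ l) ⟩
      encode G μ j +ᶠ 0#           ≡⟨ R.+-identityʳ _ ⟩
      encode G μ j                 ∎) (all-filter (λ j → a j ≟F 0#) L)
      where open ≡-Reasoning

    ∑-wtOn-line : ∀ μ → ∑ elements (λ l → wtOn L (encode G (μ +ᵐ l ·ᵐ ma))) + wtOn L a
                        ≡ q * wtOn (offSupp a L) (encode G μ) + q * wtOn L a
    ∑-wtOn-line μ = begin
      ∑ elements (λ l → wtOn L (encode G (μ +ᵐ l ·ᵐ ma))) + d                 ≡⟨ cong (_+ d) (∑-cong elements split) ⟩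
      ∑ elements (λ l → w′ + wtOn T (λ j → encode G μ j +ᶠ l *ᶠ a j)) + d     ≡⟨ cong (_+ d) (∑-+ (λ _ → w′) _ elements) ⟩
      ∑ elements (λ _ → w′) + ∑ elements (λ l → wtOn T (λ j → encode G μ j +ᶠ l *ᶠ a j)) + d
                                                                             ≡⟨ +-assoc (∑ elements (λ _ → w′)) _ d ⟩
      ∑ elements (λ _ → w′) + (∑ elements (λ l → wtOn T (λ j → encode G μ j +ᶠ l *ᶠ a j)) + d)
                                                                             ≡⟨ cong₂ _+_ (∑-const w′ elements) (∑-wtOn-supp-line a (encode G μ) L) ⟩
      q * w′ + q * d                                                         ∎
      where
      open ≡-Reasoning
      d = wtOn L a
      w′ = wtOn (offSupp a L) (encode G μ)
      T = supp a L
      split : ∀ l → wtOn L (encode G (μ +ᵐ l ·ᵐ ma)) ≡ w′ + wtOn T (λ j → encode G μ j +ᶠ l *ᶠ a j)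
      split l = trans (wtOn-split a _ L) (cong₂ _+_ (wtOn-cong (encode-line-offSupp μ l))
                                                    (wtOn-cong (All.universal (encode-line μ l) T)))

    wtOn-line-≥ : ∀ {μ} → NonzeroOn (offSupp a L) (encode G μ) → ∀ l → wtOn L a ≤ wtOn L (encode G (μ +ᵐ l ·ᵐ ma))
    wtOn-line-≥ {μ} nz l =
      a-min _ (Anyₚ.filter⁻ (λ j → a j ≟F 0#) (NonzeroOn-cong (All.map sym (encode-line-offSupp μ l)) nz))

    wtOn≤q*wtOn-offSupp : ∀ {μ} → NonzeroOn (offSupp a L) (encode G μ) → wtOn L a ≤ q * wtOn (offSupp a L) (encode G μ)
    wtOn≤q*wtOn-offSupp {μ} nz = +-cancelʳ-≤ (q * d) d _ (begin
      d + q * d                                                ≡⟨ +-comm d _ ⟩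
      q * d + d                                                ≡⟨ cong (_+ d) (∑-const d elements) ⟨
      ∑ elements (λ _ → d) + d                                 ≤⟨ +-monoˡ-≤ d (∑-mono (All.universal (wtOn-line-≥ nz) elements)) ⟩
      ∑ elements (λ l → wtOn L (encode G (μ +ᵐ l ·ᵐ ma))) + d  ≡⟨ ∑-wtOn-line μ ⟩
      q * wtOn (offSupp a L) (encode G μ) + q * d              ∎)
      where
      open ≤-Reasoning
      d = wtOn L a

    -- Subtracting the right multiple of a kills the coordinate j and creates no new nonzero
    -- coordinate, so the result is lighter than a and hence zero.
    vanishing-offSupp⇒multiple : ∀ μ → All (λ j → encode G μ j ≡ 0#) (offSupp a L) →
                                 ∀ {j} → j ∈ L → encode G μ j ≢ 0# → ∃ λ l → All (λ i → encode G μ i ≡ l *ᶠ a i) L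
    vanishing-offSupp⇒multiple μ μ≡0 {j} j∈L μj≢0 = l , All.map multiple (lighter⇒zero a-min ν ν-lighter)
      where
      aj≢0 : a j ≢ 0#
      aj≢0 aj≡0 = μj≢0 (All.lookup μ≡0 (∈-filter⁺ (λ i → a i ≟F 0#) j∈L aj≡0))
      y = proj₁ (inverse (a j) aj≢0)
      l = encode G μ j *ᶠ y
      l*aj≡μj : l *ᶠ a j ≡ encode G μ j
      l*aj≡μj = trans (R.*-assoc _ y (a j))
                      (trans (cong (encode G μ j *ᶠ_) (trans (R.*-comm y (a j)) (proj₂ (inverse (a j) aj≢0))))
                             (R.*-identityʳ _))
      ν = μ +ᵐ -ᶠ l ·ᵐ ma
      ν-offSupp : ∀ {i} → i ∈ L → a i ≡ 0# → encode G ν i ≡ 0#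
      ν-offSupp i∈L ai≡0 = let i∈offSupp = ∈-filter⁺ (λ i → a i ≟F 0#) i∈L ai≡0 in
        trans (All.lookup (encode-line-offSupp μ (-ᶠ l)) i∈offSupp) (All.lookup μ≡0 i∈offSupp)
      νj≡0 : encode G ν j ≡ 0#
      νj≡0 = trans (encode-line μ (-ᶠ l) j) (l*y≡x⇒x+[-l]*y≡0 _ l (a j) l*aj≡μj)
      ν-lighter : wtOn L (encode G ν) < wtOn L a
      ν-lighter = ∑-<
        (All.tabulate λ {i} i∈L → 𝟙-mono (¬? (encode G ν i ≟F 0#)) (¬? (a i ≟F 0#)) λ νi≢0 ai≡0 → νi≢0 (ν-offSupp i∈L ai≡0))
        (Any.map (λ { refl → 𝟙-< (¬? (encode G ν j ≟F 0#)) (¬? (a j ≟F 0#)) (λ νj≢0 → νj≢0 νj≡0) aj≢0 }) j∈L)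
      multiple : ∀ {i} → encode G ν i ≡ 0# → encode G μ i ≡ l *ᶠ a i
      multiple {i} νi≡0 = x+[-l]*y≡0⇒x≡l*y _ l (a i) (trans (sym (encode-line μ (-ᶠ l) i)) νi≡0)

    offSupp-kernel : ∀ μ → All (λ j → encode G μ j ≡ 0#) (offSupp a L) → ∃ λ l → All (λ j → encode G μ j ≡ l *ᶠ a j) L
    offSupp-kernel μ μ≡0 with NonzeroOn? L (encode G μ)
    ... | no  ¬nz = 0# , All.map (λ μj≡0 → trans μj≡0 (sym (R.zeroˡ _))) (¬NonzeroOn⇒zero ¬nz)
    ... | yes nz  = let (j , j∈L , μj≢0) = find nz in vanishing-offSupp⇒multiple μ μ≡0 j∈L μj≢0

    offSupp-agree⇒on-line : LinIndepOn L G → ∀ {μ μ′} → All (λ j → encode G μ j ≡ encode G μ′ j) (offSupp a L) →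
                             ∃ λ l → μ ≗ μ′ +ᵐ l ·ᵐ ma
    offSupp-agree⇒on-line indep {μ} {μ′} agree = l , encode-injectiveOn indep (All.map on-line δ≡la)
      where
      δ = μ +ᵐ -ᶠ 1# ·ᵐ μ′
      δ≡0 : All (λ j → encode G δ j ≡ 0#) (offSupp a L)
      δ≡0 = All.map (λ {j} e → trans (encode-+· G μ (-ᶠ 1#) μ′ j)
                                     (l*y≡x⇒x+[-l]*y≡0 _ 1# _ (trans (R.*-identityˡ _) (sym e)))) agree
      l = proj₁ (offSupp-kernel δ δ≡0)
      δ≡la = proj₂ (offSupp-kernel δ δ≡0)
      on-line : ∀ {j} → encode G δ j ≡ l *ᶠ a j → encode G μ j ≡ encode G (μ′ +ᵐ l ·ᵐ ma) j
      on-line {j} δj≡laj = begin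
        encode G μ j                           ≡⟨ x+[-l]*y≡z⇒x≡l*y+z _ 1# _ (trans (sym (encode-+· G μ (-ᶠ 1#) μ′ j)) δj≡laj) ⟩
        1# *ᶠ encode G μ′ j +ᶠ l *ᶠ a j        ≡⟨ cong (_+ᶠ l *ᶠ a j) (R.*-identityˡ _) ⟩
        encode G μ′ j +ᶠ l *ᶠ a j              ≡⟨ encode-line μ′ l j ⟨
        encode G (μ′ +ᵐ l ·ᵐ ma) j             ∎
        where open ≡-Reasoning

  -- Res(C,a) is generated by the rows of G other than a row i with ma i ≠ 0, restricted to offSupp a L.

  module Residual {k n} (G : GenMatrix (suc k) n) (L : List (Fin n)) (ma : Fin (suc k) → Carrier) (a : Word n)
                  (ma↦a : encode G ma ≗ a) (a-min : MinWtAtLeast L G (wtOn L a))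
                  (i : Fin (suc k)) (ma-i≢0 : ma i ≢ 0#) where
    open Puncturing G L ma a ma↦a a-min

    residual-linIndep : LinIndepOn L G → LinIndepOn (offSupp a L) (removeAt G i)
    residual-linIndep indep μ′ μ′G≡0 x = begin
      μ′ x                                       ≡⟨ insertAt-punchIn μ′ i 0# x ⟨
      μ (punchIn i x)                            ≡⟨ μ≗l·ma (punchIn i x) ⟩
      0# +ᶠ l *ᶠ ma (punchIn i x)                ≡⟨ cong (λ l → 0# +ᶠ l *ᶠ ma (punchIn i x)) l≡0 ⟩
      0# +ᶠ 0# *ᶠ ma (punchIn i x)               ≡⟨ trans (R.+-identityˡ _) (R.zeroˡ _) ⟩
      0#                                         ∎
      where
      open ≡-Reasoning
      μ = insertAt μ′ i 0#
      μG≡0G : All (λ j → encode G μ j ≡ encode G 0ᵐ j) (offSupp a L)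
      μG≡0G = All.map (λ {j} e → trans (encode-insertAt G i μ′ j) (trans e (sym (encode-0 G (λ _ → refl) j)))) μ′G≡0
      l = proj₁ (offSupp-agree⇒on-line indep μG≡0G)
      μ≗l·ma = proj₂ (offSupp-agree⇒on-line indep μG≡0G)
      l≡0 : l ≡ 0#
      l≡0 = *-cancelʳ-≢0 ma-i≢0 (begin
        l *ᶠ ma i            ≡⟨ R.+-identityˡ _ ⟨
        0# +ᶠ l *ᶠ ma i      ≡⟨ μ≗l·ma i ⟨
        μ i                  ≡⟨ insertAt-lookup μ′ i 0# ⟩
        0#                   ≡⟨ R.zeroˡ (ma i) ⟨
        0# *ᶠ ma i           ∎)

    residual-minWt : MinWtAtLeast (offSupp a L) (removeAt G i) (ceilDiv (wtOn L a) q)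
    residual-minWt μ′ nz′ = m≤n*q⇒⌈m/q⌉≤n _ _ q (begin
      wtOn L a                                 ≤⟨ wtOn≤q*wtOn-offSupp nz ⟩
      q * wtOn L′ (encode G μ)                 ≡⟨ cong (q *_) (wtOn-cong (All.universal (encode-insertAt G i μ′) L′)) ⟩
      q * wtOn L′ (encode (removeAt G i) μ′)   ≡⟨ *-comm q _ ⟩
      wtOn L′ (encode (removeAt G i) μ′) * q   ∎)
      where
      open ≤-Reasoning
      L′ = offSupp a L
      μ = insertAt μ′ i 0#
      nz : NonzeroOn L′ (encode G μ)
      nz = NonzeroOn-cong (All.universal (sym ∘ encode-insertAt G i μ′) L′) nz′

  minimumWeightCodeword : ∀ {k n} (L : List (Fin n)) (G : GenMatrix (suc k) n) → LinIndepOn L G →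
                          ∃ λ ma → NonzeroOn L (encode G ma) × MinWtAtLeast L G (wtOn L (encode G ma))
  minimumWeightCodeword {k} L G indep = ma , proj₁ (proj₂ (proj₂ minimal)) , ma-min
    where
    e₀ : Fin (suc k) → Carrier
    e₀ zero    = 1#
    e₀ (suc _) = 0#
    e₀-nonzero : NonzeroOn L (encode G e₀)
    e₀-nonzero with NonzeroOn? L (encode G e₀)
    ... | yes nz  = nz
    ... | no  ¬nz = ⊥-elim (0≢1 (sym (indep e₀ (¬NonzeroOn⇒zero ¬nz) zero)))
    nonzero-message : Any (λ m → NonzeroOn L (encode G m)) (messages (suc k))
    nonzero-message = let (m , m∈ , m≗e₀) = ∈-messages (suc k) e₀ in
      Any.map (λ { refl → NonzeroOn-cong (All.universal (sym ∘ encode-cong G m≗e₀) L) e₀-nonzero }) m∈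
    minimal = minimiser (λ m → NonzeroOn? L (encode G m)) (λ m → wtOn L (encode G m)) nonzero-message
    ma = proj₁ minimal
    ma-min : MinWtAtLeast L G (wtOn L (encode G ma))
    ma-min m nz = let (m′ , m′∈ , m′≗m) = ∈-messages (suc k) m
                      same = All.universal (encode-cong G m′≗m) L in
      ≤-trans (All.lookup (proj₂ (proj₂ (proj₂ minimal))) m′∈ (NonzeroOn-cong (All.map sym same) nz))
              (≤-reflexive (wtOn-cong same))

  griesmer-bound : ∀ k {n} (L : List (Fin n)) (G : GenMatrix k n) {D} →
                   LinIndepOn L G → MinWtAtLeast L G D → griesmer q k D ≤ length L
  griesmer-bound zero    L G _     _     = z≤n
  griesmer-bound (suc k) L G indep D-min = begin
    griesmer q (suc k) _                 ≤⟨ griesmer-mono q (suc k) (D-min ma ma-nonzero) ⟩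
    griesmer q (suc k) d                 ≡⟨ griesmer-suc q k d ⟩
    d + griesmer q k (ceilDiv d q)       ≤⟨ +-monoʳ-≤ d (griesmer-bound k _ _ (residual-linIndep indep) residual-minWt) ⟩
    d + length (offSupp a L)             ≡⟨ +-comm d _ ⟩
    length (offSupp a L) + d             ≡⟨ length-offSupp a L ⟨
    length L                             ∎
    where
    open ≤-Reasoning
    minimal = minimumWeightCodeword L G indep
    ma = proj₁ minimal
    ma-nonzero = proj₁ (proj₂ minimal)
    a = encode G ma
    d = wtOn L a
    i = nonzero-encoding⇒nonzero-message G L ma ma-nonzero
    open Residual G L ma a (λ _ → refl) (proj₂ (proj₂ minimal)) (proj₁ i) (proj₂ i)

  -- Preimages in a Griesmer code

  module GriesmerPreimages {k d : ℕ} (G : GenMatrix (suc k) (griesmer q (suc k) d))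
           (isCode : IsCode (griesmer q (suc k) d) (suc k) d G)
           (a : Word (griesmer q (suc k) d)) (a∈C : InCode G a) (wt-a : wt a ≡ d)
           (c′ : List Carrier) (c′-min : MinWtRes G a c′) where

    private
      L = allFin (griesmer q (suc k) d)
      L′ = offSupp a L
      u = ceilDiv d q
      ma = proj₁ a∈C
      ma↦a = proj₂ a∈C

    wtOn-a : wtOn L a ≡ d
    wtOn-a = trans (sym (listWt-map a L)) wt-a

    linIndep : LinIndepOn L G
    linIndep m mG≡0 = proj₁ isCode m (λ j → All.lookup mG≡0 (∈-allFin j))

    a-min : MinWtAtLeast L G (wtOn L a)
    a-min m nz = begin
      wtOn L a              ≡⟨ wtOn-a ⟩
      d                     ≤⟨ proj₁ (proj₂ isCode) (encode G m) (m , λ _ → refl) (let (j , _ , mGj≢0) = find nz in j , mGj≢0) ⟩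
      wt (encode G m)       ≡⟨ listWt-map (encode G m) L ⟩
      wtOn L (encode G m)   ∎
      where open ≤-Reasoning

    0<d : 0 < d
    0<d = let (c , _ , (j , cj≢0) , wt-c) = proj₂ (proj₂ isCode) in
      subst (0 <_) (trans (sym (listWt-map c L)) wt-c) (NonzeroOn⇒0<wtOn (Any.map (λ { refl → cj≢0 }) (∈-allFin j)))

    ma-nonzero : ∃ λ i → ma i ≢ 0#
    ma-nonzero = nonzero-encoding⇒nonzero-message G L ma
      (NonzeroOn-cong (All.universal (sym ∘ ma↦a) L) (0<wtOn⇒NonzeroOn (subst (0 <_) (sym wtOn-a) 0<d)))

    private
      i₀ = proj₁ ma-nonzero
    open Puncturing G L ma a ma↦a a-min
    open Residual G L ma a ma↦a a-min i₀ (proj₂ ma-nonzero)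

    IsPreimage : (Fin (suc k) → Carrier) → Set
    IsPreimage μ = puncture a (encode G μ) ≡ c′

    preimage : ∃ IsPreimage
    preimage with proj₁ c′-min
    ... | c₀ , (mc , mc↦c₀) , c₀↦c′ = mc , trans (map-cong mc↦c₀ L′) c₀↦c′

    private
      mc = proj₁ preimage
      mc-preimage = proj₂ preimage

    lineWt : (Fin (suc k) → Carrier) → Carrier → ℕ
    lineWt μ l = wt (encode G (μ +ᵐ l ·ᵐ ma))

    module _ {μ} (μ↦c′ : IsPreimage μ) where

      wtOn-L′≡wt-c′ : wtOn L′ (encode G μ) ≡ listWt c′
      wtOn-L′≡wt-c′ = trans (sym (listWt-map _ L′)) (cong listWt μ↦c′)

      nonzero-offSupp : NonzeroOn L′ (encode G μ)
      nonzero-offSupp = Anyₚ.map⁻ (subst NonzeroL (sym μ↦c′) (proj₁ (proj₂ c′-min)))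

      lineWt-≥ : ∀ l → d ≤ lineWt μ l
      lineWt-≥ l = subst₂ _≤_ wtOn-a (sym (listWt-map _ L)) (wtOn-line-≥ nonzero-offSupp l)

      ∑-lineWt : ∑ elements (lineWt μ) + d ≡ q * listWt c′ + q * d
      ∑-lineWt = begin
        ∑ elements (lineWt μ) + d                                        ≡⟨ cong₂ _+_ (∑-cong elements (λ l → listWt-map _ L)) (sym wtOn-a) ⟩
        ∑ elements (λ l → wtOn L (encode G (μ +ᵐ l ·ᵐ ma))) + wtOn L a    ≡⟨ ∑-wtOn-line μ ⟩
        q * wtOn L′ (encode G μ) + q * wtOn L a                          ≡⟨ cong₂ (λ x y → q * x + q * y) wtOn-L′≡wt-c′ wtOn-a ⟩
        q * listWt c′ + q * d                                            ∎
        where open ≡-Reasoning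

    residual-minWt-c′ : MinWtAtLeast L′ (removeAt G i₀) (listWt c′)
    residual-minWt-c′ μ′ nz′ = begin
      listWt c′                                ≤⟨ proj₂ (proj₂ c′-min) (encode G μ) (μ , λ _ → refl) (Anyₚ.map⁺ nz) ⟩
      listWt (puncture a (encode G μ))         ≡⟨ listWt-map _ L′ ⟩
      wtOn L′ (encode G μ)                     ≡⟨ wtOn-cong (All.universal (encode-insertAt G i₀ μ′) L′) ⟩
      wtOn L′ (encode (removeAt G i₀) μ′)      ∎
      where
      open ≤-Reasoning
      μ = insertAt μ′ i₀ 0#
      nz : NonzeroOn L′ (encode G μ)
      nz = NonzeroOn-cong (All.universal (sym ∘ encode-insertAt G i₀ μ′) L′) nz′

    length-L′ : length L′ ≡ griesmer q k u
    length-L′ = +-cancelʳ-≡ d _ _ (begin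
      length L′ + d            ≡⟨ cong (length L′ +_) wtOn-a ⟨
      length L′ + wtOn L a     ≡⟨ length-offSupp a L ⟨
      length L                 ≡⟨ length-tabulate id ⟩
      griesmer q (suc k) d     ≡⟨ griesmer-suc q k d ⟩
      d + griesmer q k u       ≡⟨ +-comm d _ ⟩
      griesmer q k u + d       ∎)
      where open ≡-Reasoning

    wt-c′≤u : listWt c′ ≤ u
    wt-c′≤u = griesmer-cancel-≤ q k (subst (0 <_) length-L′ (Any⇒0<length (nonzero-offSupp mc-preimage)))
      (subst (griesmer q k (listWt c′) ≤_) length-L′
             (griesmer-bound k L′ (removeAt G i₀) (residual-linIndep linIndep) residual-minWt-c′))

    ∑-lineWt≤ : ∀ {μ} → IsPreimage μ → ∑ elements (lineWt μ) + d ≤ q * u + q * d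
    ∑-lineWt≤ μ↦c′ = ≤-trans (≤-reflexive (∑-lineWt μ↦c′)) (+-monoˡ-≤ (q * d) (*-monoʳ-≤ q wt-c′≤u))

    line : Carrier → Fin (suc k) → Carrier
    line l = mc +ᵐ l ·ᵐ ma

    line-preimage : ∀ l → IsPreimage (line l)
    line-preimage l = trans (map-cong-local (encode-line-offSupp mc l)) mc-preimage

    preimage⇒on-line : ∀ {m} → IsPreimage m → ∃ λ l → m ≗ line l
    preimage⇒on-line m↦c′ = offSupp-agree⇒on-line linIndep (map-≡⇒All L′ (trans m↦c′ (sym mc-preimage)))

    line-injective : ∀ {l l′} → line l ≗ line l′ → l ≡ l′
    line-injective e = *-cancelʳ-≢0 (proj₂ ma-nonzero) (∙-cancelˡ (mc i₀) _ _ (e i₀))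

    numPreimages≡ : numPreimagesOfWt G a c′ d ≡ ∑ elements (λ l → 𝟙 (lineWt mc l ≟ d))
    numPreimages≡ = begin
      numPreimagesOfWt G a c′ d                                                ≡⟨ length-filter≡∑𝟙 IsPreimageOfWt? (messages (suc k)) ⟩
      ∑ (messages (suc k)) (λ m → 𝟙 (IsPreimageOfWt? m))                      ≡⟨ ∑-cong (messages (suc k)) count-lines ⟩
      ∑ (messages (suc k)) (λ m → ∑ elements (λ l → 𝟙 (OnLineOfWt? m l)))     ≡⟨ ∑-swap _ (messages (suc k)) elements ⟩
      ∑ elements (λ l → ∑ (messages (suc k)) (λ m → 𝟙 (OnLineOfWt? m l)))     ≡⟨ ∑-cong elements count-messages ⟩
      ∑ elements (λ l → 𝟙 (lineWt mc l ≟ d))                                  ∎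
      where
      open ≡-Reasoning
      IsPreimageOfWt? : ∀ m → Dec (IsPreimage m × wt (encode G m) ≡ d)
      IsPreimageOfWt? m = ≡-dec _≟F_ (puncture a (encode G m)) c′ ×-dec (wt (encode G m) ≟ d)
      OnLineOfWt? : ∀ m l → Dec (m ≗ line l × lineWt mc l ≡ d)
      OnLineOfWt? m l = (m ≗? line l) ×-dec (lineWt mc l ≟ d)
      on-line⇒preimage : ∀ {m l} → m ≗ line l × lineWt mc l ≡ d → IsPreimage m × wt (encode G m) ≡ d
      on-line⇒preimage (m≗l , wt≡d) = trans (map-cong (encode-cong G m≗l) L′) (line-preimage _)
                                     , trans (wt-cong (encode-cong G m≗l)) wt≡d
      count-lines : ∀ m → 𝟙 (IsPreimageOfWt? m) ≡ ∑ elements (λ l → 𝟙 (OnLineOfWt? m l))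
      count-lines m with IsPreimageOfWt? m
      ... | no ¬pre = sym (All¬⇒∑𝟙≡0 (OnLineOfWt? m) (All.universal (λ _ → ¬pre ∘ on-line⇒preimage) elements))
      ... | yes (m↦c′ , wt≡d) = let (l₀ , m≗l₀) = preimage⇒on-line m↦c′ in sym (trans
              (∑-cong elements λ l → 𝟙-cong (OnLineOfWt? m l) (l ≟F l₀)
                 (λ (m≗l , _) → line-injective (λ i → trans (sym (m≗l i)) (m≗l₀ i)))
                 (λ { refl → m≗l₀ , trans (wt-cong (encode-cong G (sym ∘ m≗l₀))) wt≡d }))
              (∑𝟙-≟-unique _≟F_ elements-unique (elements-complete l₀)))
      count-messages : ∀ l → ∑ (messages (suc k)) (λ m → 𝟙 (OnLineOfWt? m l)) ≡ 𝟙 (lineWt mc l ≟ d)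
      count-messages l = begin
        ∑ (messages (suc k)) (λ m → 𝟙 (OnLineOfWt? m l))                      ≡⟨ ∑-cong (messages (suc k)) (λ m → 𝟙-×-dec (m ≗? line l) (lineWt mc l ≟ d)) ⟩
        ∑ (messages (suc k)) (λ m → 𝟙 (m ≗? line l) * 𝟙 (lineWt mc l ≟ d))    ≡⟨ ∑-*ʳ (𝟙 (lineWt mc l ≟ d)) _ (messages (suc k)) ⟩
        ∑ (messages (suc k)) (λ m → 𝟙 (m ≗? line l)) * 𝟙 (lineWt mc l ≟ d)    ≡⟨ cong (_* 𝟙 (lineWt mc l ≟ d)) (∑-messages-≗ (suc k) (line l)) ⟩
        1 * 𝟙 (lineWt mc l ≟ d)                                              ≡⟨ *-identityˡ _ ⟩
        𝟙 (lineWt mc l ≟ d)                                                  ∎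

    d+q≤u*q+count : d + q ≤ u * q + ∑ elements (λ l → 𝟙 (lineWt mc l ≟ d))
    d+q≤u*q+count = +-cancelʳ-≤ (q * d) _ _ (begin
      d + q + q * d                   ≡⟨ rearrange₁ d q ⟩
      q * suc d + d                   ≤⟨ +-monoˡ-≤ d (length*suc≤∑+count (lineWt mc) d (All.universal (lineWt-≥ mc-preimage) elements)) ⟩
      ∑ elements (lineWt mc) + N + d  ≡⟨ xy∙z≈xz∙y (∑ elements (lineWt mc)) N d ⟩
      ∑ elements (lineWt mc) + d + N  ≤⟨ +-monoˡ-≤ N (∑-lineWt≤ mc-preimage) ⟩
      q * u + q * d + N               ≡⟨ rearrange₂ q u d N ⟩
      u * q + N + q * d               ∎)
      where
      open ≤-Reasoning
      N = ∑ elements (λ l → 𝟙 (lineWt mc l ≟ d))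
      rearrange₁ : ∀ d q → d + q + q * d ≡ q * suc d + d
      rearrange₁ = solve-∀
      rearrange₂ : ∀ q u d N → q * u + q * d + N ≡ u * q + N + q * d
      rearrange₂ = solve-∀

    preimage-count-≥ : d + q ∸ u * q ≤ numPreimagesOfWt G a c′ d
    preimage-count-≥ = subst (d + q ∸ u * q ≤_) (sym numPreimages≡) (m≤n+o⇒m∸n≤o (d + q) (u * q) d+q≤u*q+count)

    preimage-exists : ∃ λ c → InCode G c × puncture a c ≡ c′ × wt c ≡ d
    preimage-exists = let (l , _ , wt≡d) = find (1≤∑𝟙⇒Any (λ l → lineWt mc l ≟ d) elements 0<count) in
      encode G (line l) , (line l , λ _ → refl) , line-preimage l , wt≡d
      where
      0<count : 0 < ∑ elements (λ l → 𝟙 (lineWt mc l ≟ d))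
      0<count = +-cancelˡ-≤ (u * q) 1 _
        (≤-trans (≤-reflexive (+-comm (u * q) 1)) (≤-trans (⌈m/q⌉*q<m+q d q) d+q≤u*q+count))

    module _ (q∣d : q ∣ d) where

      u*q≡d : u * q ≡ d
      u*q≡d = trans (cong (λ x → ceilDiv x q * q) d≡t*q) (trans (cong (_* q) (⌈m*q/q⌉≡m t q)) (sym d≡t*q))
        where open _∣_ q∣d renaming (quotient to t; equality to d≡t*q)

      lineWt≡d : ∀ {μ} → IsPreimage μ → All (λ l → lineWt μ l ≡ d) elements
      lineWt≡d {μ} μ↦c′ = ∑≤length*⇒all≡ (lineWt μ) d (All.universal (lineWt-≥ μ↦c′) elements) (+-cancelʳ-≤ d _ _ (begin
        ∑ elements (lineWt μ) + d      ≤⟨ ∑-lineWt≤ μ↦c′ ⟩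
        q * u + q * d                  ≡⟨ cong (_+ q * d) (trans (*-comm q u) u*q≡d) ⟩
        d + q * d                      ≡⟨ +-comm d _ ⟩
        q * d + d                      ∎))
        where open ≤-Reasoning

      preimage-wt≡d : ∀ c → InCode G c → puncture a c ≡ c′ → wt c ≡ d
      preimage-wt≡d c (μ , μ↦c) c↦c′ = begin
        wt c           ≡⟨ wt-cong (λ j → trans (sym (μ↦c j)) (sym (encode-cong G (+ᵐ0·ᵐ μ ma) j))) ⟩
        lineWt μ 0#    ≡⟨ All.lookup (lineWt≡d (trans (map-cong μ↦c L′) c↦c′)) (elements-complete 0#) ⟩
        d              ∎
        where open ≡-Reasoning

      numPreimages≡q : numPreimagesOfWt G a c′ d ≡ q
      numPreimages≡q = trans numPreimages≡
        (trans (∑-congᴬ (All.map (λ {l} → 𝟙-yes (lineWt mc l ≟ d)) (lineWt≡d mc-preimage))) (∑-1 elements))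

proposition4p2 : (F : FiniteField) → let open Code F in
    (k d : ℕ) (G : GenMatrix k (griesmer (FiniteField.q F) k d)) →
    IsCode (griesmer (FiniteField.q F) k d) k d G →
    (a : Word (griesmer (FiniteField.q F) k d)) → InCode G a → wt a ≡ d →
    (c' : List (FiniteField.Carrier F)) → MinWtRes G a c' →
    (FiniteField.q F ∣ d →
       (∀ c → InCode G c → puncture a c ≡ c' → wt c ≡ d)
       × numPreimagesOfWt G a c' d ≡ FiniteField.q F)
    × (¬ (FiniteField.q F ∣ d) →
       (∃ λ c → InCode G c × puncture a c ≡ c' × wt c ≡ d)
       × d + FiniteField.q F ∸ ceilDiv d (FiniteField.q F) * FiniteField.q F ≤ numPreimagesOfWt G a c' d)
    × (∃ λ c → InCode G c × puncture a c ≡ c' × wt c ≡ d)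
-- For k = 0 the length g_q(0,d) is 0, so the nonzero codeword promised by IsCode has no coordinate.
proposition4p2 F zero    d G (_ , _ , _ , _ , (() , _) , _) a a∈C wt-a c′ c′-min
proposition4p2 F (suc k) d G isCode a a∈C wt-a c′ c′-min =
    (λ q∣d → preimage-wt≡d q∣d , numPreimages≡q q∣d)
  , (λ _ → preimage-exists , preimage-count-≥)
  , preimage-exists
  where open CodeTheory.GriesmerPreimages F G isCode a a∈C wt-a c′ c′-min
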